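{- If a graph $G$ is $(1,1,2,2)$-colorable, then $\chi_{\rho}(S(G))\le 5$.
   Context: All graphs are simple. For a positive integer $i$, an $i$-packing in $G$ is a set $W\subseteq V(G)$ such that any two distinct vertices of $W$ are at distance greater than $i$ in $G$. For a non-decreasing sequence $(s_1,\ldots,s_k)$ of positive integers, an $(s_1,\ldots,s_k)$-coloring of $G$ is a partition of $V(G)$ into sets $\Pi_1,\ldots,\Pi_k$ with $\Pi_j$ an $s_j$-packing for each $j$; $G$ is $(s_1,\ldots,s_k)$-colorable if such a partition exists. The packing chromatic number $\chi_{\rho}(G)$ is the smallest $k$ such that $G$ is $(1,2,\ldots,k)$-colorable. The subdivision $S(G)$ is the graph obtained from $G$ by inserting one new vertex on each edge (each edge replaced by a path of length $2$). -}

module Defs where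

open import Data.Nat using (ℕ; zero; suc; _≤_)
open import Data.Fin using (Fin; _<_) renaming (zero to fzero; suc to fsuc)
open import Data.Fin.Base using (toℕ)
open import Data.Product using (Σ; _×_; _,_; proj₁; proj₂; ∃)
open import Data.Sum using (_⊎_; inj₁; inj₂)
open import Data.Empty using (⊥)
open import Relation.Nullary using (¬_)
open import Relation.Binary.PropositionalEquality using (_≡_; _≢_)

record Graph (V : Set) : Set₁ where
  field
    Adj    : V → V → Set
    sym    : ∀ {u v} → Adj u v → Adj v u
    irrefl : ∀ {v} → ¬ Adj v v
open Graph public

data Walk {V : Set} (G : Graph V) : V → V → ℕ → Set where
  here : ∀ {v} → Walk G v v zero
  step : ∀ {u w v k} → Adj G u w → Walk G w v k → Walk G u v (suc k)

-- dist_G(u,v) > i  iff there is no walk of length ≤ i from u to v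
-- (covers dist = ∞ for different components).
DistGreater : {V : Set} → Graph V → ℕ → V → V → Set
DistGreater G i u v = ∀ k → k ≤ i → ¬ Walk G u v k

IsPacking : {V : Set} → Graph V → ℕ → (V → Set) → Set
IsPacking G i W = ∀ u v → W u → W v → u ≢ v → DistGreater G i u v

IsColorable : {V : Set} → Graph V → (k : ℕ) → (Fin k → ℕ) → Set
IsColorable {V} G k s =
  Σ (V → Fin k) λ c → ∀ j → IsPacking G (s j) (λ v → c v ≡ j)

packSeq : (k : ℕ) → Fin k → ℕ
packSeq k j = suc (toℕ j)

PackingChromaticAtMost : {V : Set} → Graph V → ℕ → Set
PackingChromaticAtMost G m = Σ ℕ λ k → k ≤ m × IsColorable G k (packSeq k)

seq1122 : Fin 4 → ℕ
seq1122 fzero = 1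
seq1122 (fsuc fzero) = 1
seq1122 (fsuc (fsuc fzero)) = 2
seq1122 (fsuc (fsuc (fsuc fzero))) = 2

Edge : {n : ℕ} → Graph (Fin n) → Set
Edge {n} G = Σ (Fin n × Fin n) λ p → (proj₁ p < proj₂ p) × Adj G (proj₁ p) (proj₂ p)

Inc : {n : ℕ} (G : Graph (Fin n)) → Fin n → Edge G → Set
Inc G x ((i , j) , _) = (x ≡ i) ⊎ (x ≡ j)

SAdj : {n : ℕ} (G : Graph (Fin n)) → (Fin n ⊎ Edge G) → (Fin n ⊎ Edge G) → Set
SAdj G (inj₁ x) (inj₁ y) = ⊥
SAdj G (inj₁ x) (inj₂ e) = Inc G x e
SAdj G (inj₂ e) (inj₁ x) = Inc G x e
SAdj G (inj₂ e) (inj₂ f) = ⊥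

SAdj-sym : {n : ℕ} (G : Graph (Fin n)) {u v : Fin n ⊎ Edge G} → SAdj G u v → SAdj G v u
SAdj-sym G {inj₁ x} {inj₂ e} p = p
SAdj-sym G {inj₂ e} {inj₁ x} p = p

SAdj-irrefl : {n : ℕ} (G : Graph (Fin n)) {v : Fin n ⊎ Edge G} → ¬ SAdj G v v
SAdj-irrefl G {inj₁ x} ()
SAdj-irrefl G {inj₂ e} ()

Subdivision : {n : ℕ} (G : Graph (Fin n)) → Graph (Fin n ⊎ Edge G)
Subdivision G = record { Adj = SAdj G ; sym = SAdj-sym G ; irrefl = SAdj-irrefl G }

module Submission where

-- Colour every subdivision vertex 1 and give an original vertex of colour j in the
-- (1,1,2,2)-colouring the colour j + 2. Subdivision vertices are pairwise non-adjacent.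
-- A walk of length k in S(G) between original vertices contracts to a walk of length
-- at most k/2 in G, so an s-packing of G is a (2s+1)-packing of S(G); and the required
-- distances 2, 3, 4, 5 are at most 2s+1 for s = 1, 1, 2, 2.

open import Defs
open import Data.Nat using (ℕ; zero; suc; _+_; _≤_; z≤n; s≤s)
open import Data.Nat.Properties using (+-suc; ≤-trans; ≤-refl; ≤-reflexive; m≤n⇒m≤1+n; ≤-pred)
open import Data.Fin using (Fin) renaming (zero to fzero; suc to fsuc)
open import Data.Fin.Properties using (_≟_; suc-injective)
open import Data.Product using (Σ; _×_; _,_)
open import Data.Sum using (_⊎_; inj₁; inj₂)
open import Relation.Nullary using (yes; no)
open import Relation.Binary.PropositionalEquality using (_≡_; _≢_; refl; cong)
open import Data.Empty using (⊥-elim)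

m+m≤1+n+n⇒m≤n : ∀ m n → m + m ≤ suc (n + n) → m ≤ n
m+m≤1+n+n⇒m≤n zero    n       _       = z≤n
m+m≤1+n+n⇒m≤n (suc m) zero    (s≤s p) rewrite +-suc m m with p
... | ()
m+m≤1+n+n⇒m≤n (suc m) (suc n) (s≤s p) rewrite +-suc m m | +-suc n n =
  s≤s (m+m≤1+n+n⇒m≤n m n (≤-pred p))

DistGreater-anti : ∀ {V} (G : Graph V) {i j u v} →
                   i ≤ j → DistGreater G j u v → DistGreater G i u v
DistGreater-anti G i≤j d k k≤i = d k (≤-trans k≤i i≤j)

module _ {n : ℕ} (G : Graph (Fin n)) where

  private
    S = Subdivision G

  Inc⇒Adj : ∀ {x y} (e : Edge G) → Inc G x e → Inc G y e → x ≢ y → Adj G x y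
  Inc⇒Adj _           (inj₁ refl) (inj₁ refl) x≢y = ⊥-elim (x≢y refl)
  Inc⇒Adj (_ , _ , a) (inj₁ refl) (inj₂ refl) _   = a
  Inc⇒Adj (_ , _ , a) (inj₂ refl) (inj₁ refl) _   = Graph.sym G a
  Inc⇒Adj _           (inj₂ refl) (inj₂ refl) x≢y = ⊥-elim (x≢y refl)

  -- Each visit to an edge vertex is two steps of the walk; it is dropped when it
  -- returns to the same original vertex and otherwise becomes one edge of G.
  contractWalk : ∀ {x y k} → Walk S (inj₁ x) (inj₁ y) k →
                 Σ ℕ λ m → (m + m ≤ k) × Walk G x y m
  contractWalk here = 0 , z≤n , here
  contractWalk (step {w = inj₁ _} () _)
  contractWalk (step {w = inj₂ _} _ (step {w = inj₂ _} () _))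
  contractWalk {x} {k = suc (suc k)} (step {w = inj₂ e} x∈e (step {w = inj₁ z} z∈e w))
    with contractWalk w | x ≟ z
  ... | m , 2m≤k , w′ | yes refl = m , m≤n⇒m≤1+n (m≤n⇒m≤1+n 2m≤k) , w′
  ... | m , 2m≤k , w′ | no x≢z   =
    suc m , s≤s (≤-trans (≤-reflexive (+-suc m m)) (s≤s 2m≤k)) , step (Inc⇒Adj e x∈e z∈e x≢z) w′

  DistGreater-subdivision : ∀ {s x y} →
    DistGreater G s x y → DistGreater S (suc (s + s)) (inj₁ x) (inj₁ y)
  DistGreater-subdivision {s} d k k≤1+2s w with contractWalk w
  ... | m , 2m≤k , w′ = d m (m+m≤1+n+n⇒m≤n m s (≤-trans 2m≤k k≤1+2s)) w′

  DistGreater-edgeVertices : ∀ {e f} → e ≢ f → DistGreater S 1 (inj₂ e) (inj₂ f)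
  DistGreater-edgeVertices e≢f .0 _         here         = e≢f refl
  DistGreater-edgeVertices e≢f .1 _         (step () here)
  DistGreater-edgeVertices e≢f (suc (suc _)) (s≤s ()) _

packSeq-shift≤ : (j : Fin 4) → packSeq 5 (fsuc j) ≤ suc (seq1122 j + seq1122 j)
packSeq-shift≤ fzero                      = s≤s (s≤s z≤n)
packSeq-shift≤ (fsuc fzero)               = ≤-refl
packSeq-shift≤ (fsuc (fsuc fzero))        = s≤s (s≤s (s≤s (s≤s z≤n)))
packSeq-shift≤ (fsuc (fsuc (fsuc fzero))) = ≤-refl

mainTheorem2 : (n : ℕ) (G : Graph (Fin n)) →
    IsColorable G 4 seq1122 → PackingChromaticAtMost (Subdivision G) 5
mainTheorem2 n G (c , c-packing) = 5 , ≤-refl , colour , colour-packing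
  where
  colour : Fin n ⊎ Edge G → Fin 5
  colour (inj₁ x) = fsuc (c x)
  colour (inj₂ _) = fzero

  colour-packing : ∀ j → IsPacking (Subdivision G) (packSeq 5 j) (λ v → colour v ≡ j)
  colour-packing fzero    (inj₁ _) _        ()   _    _
  colour-packing fzero    (inj₂ _) (inj₁ _) _    ()   _
  colour-packing fzero    (inj₂ _) (inj₂ _) _    _    u≢v =
    DistGreater-edgeVertices G (λ e≡f → u≢v (cong inj₂ e≡f))
  colour-packing (fsuc j) (inj₂ _) _        ()   _    _
  colour-packing (fsuc j) (inj₁ _) (inj₂ _) _    ()   _
  colour-packing (fsuc j) (inj₁ x) (inj₁ y) cx≡j cy≡j u≢v =
    DistGreater-anti (Subdivision G) (packSeq-shift≤ j)
      (DistGreater-subdivision G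
        (c-packing j x y (suc-injective cx≡j) (suc-injective cy≡j)
          (λ x≡y → u≢v (cong inj₁ x≡y))))
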